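{- Let $D$ be a finite digraph. Then: (a) there exists a quasikernel $Q$ of $D$ with $|N^+[Q]|\ge |V(D)|^{1/3}$; (b) there exists a $3$-kernel $Q$ of $D$ with $|N^+[Q]|\ge\frac{1}{3}|V(D)|$.
   Context: A set of vertices is independent if there are no arcs between two of its vertices. $\mathrm{dist}(S,v)$ is the minimum over $u\in S$ of the length of a shortest directed path from $u$ to $v$. A $q$-kernel is an independent set $Q$ with $\mathrm{dist}(Q,v)\le q$ for all $v\in V(D)$; a quasikernel is a $2$-kernel. For $S\subseteq V(D)$, $N^+[S]=S\cup\{v:\exists u\in S,\ uv\in E(D)\}$. -}

module Defs where

open import Data.Nat using (ℕ; zero; suc; _≤_)
open import Data.Bool using (Bool; true; false; _∨_; _∧_)
open import Data.Fin using (Fin)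
open import Data.Fin.Subset using (Subset; _∈_)
open import Data.Vec using (tabulate; lookup)
open import Data.Product using (Σ; ∃; _×_; _,_)
open import Relation.Binary.PropositionalEquality using (_≡_)

-- A finite digraph on vertex set Fin n: a (decidable) arc relation, no loops.
-- Digons (arcs in both directions) are allowed; parallel arcs are irrelevant.
record Digraph : Set where
  field
    n        : ℕ
    arc      : Fin n → Fin n → Bool
    loopless : ∀ v → arc v v ≡ false
open Digraph public

data Walk (D : Digraph) : ℕ → Fin (n D) → Fin (n D) → Set where
  here : ∀ {v} → Walk D zero v v
  step : ∀ {k u w v} → arc D u w ≡ true → Walk D k w v → Walk D (suc k) u v

-- dist(S,v) ≤ q : some u ∈ S has a directed walk (equivalently a shortest
-- directed path) of length at most q to v.
DistLe : (D : Digraph) → Subset (n D) → Fin (n D) → ℕ → Set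
DistLe D S v q = Σ (Fin (n D)) λ u → u ∈ S × ∃ λ k → k ≤ q × Walk D k u v

Independent : (D : Digraph) → Subset (n D) → Set
Independent D S = ∀ u v → u ∈ S → v ∈ S → arc D u v ≡ false

IsKernel : (q : ℕ) → (D : Digraph) → Subset (n D) → Set
IsKernel q D Q = Independent D Q × (∀ v → DistLe D Q v q)

IsQuasikernel : (D : Digraph) → Subset (n D) → Set
IsQuasikernel = IsKernel 2

anyFin : ∀ {m} → (Fin m → Bool) → Bool
anyFin {zero}  f = false
anyFin {suc m} f = f Fin.zero ∨ anyFin (λ i → f (Fin.suc i))

N⁺[_] : {D : Digraph} → Subset (n D) → Subset (n D)
N⁺[_] {D} S = tabulate λ v → lookup S v ∨ anyFin (λ u → lookup S u ∧ arc D u v)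

-- Both parts are proved by strong induction on a vertex set U ⊆ V(D), counting N⁺[·] inside U.
-- The basic move extends an independent set Q by an independent J avoiding N⁺[Q]: replacing Q by
-- J ∪ (Q ∖ N⁺(J)) keeps independence and lengthens distances from Q by at most one arc.
-- (a) For v ∈ U, extend v by a quasikernel K of U ∖ N⁺[v]. If a = |U ∩ N⁺[K]| has a³ ≥ |U|
-- we are done; otherwise extend K by a large quasikernel of U ∖ N⁺[K].
-- (b) Adding a vertex of in-degree ≤ out-degree and recursing outside its in- and closed
-- out-neighbourhood gives an independent J with |U| ≤ 2|U ∩ N⁺[J]|. If the quasikernel Q of (a)
-- has |V| > 3|N⁺[Q]|, extend Q by such a J for V ∖ N⁺[Q]: the result is a 3-kernel.
module Submission where

open import Defs
open import Data.Nat using (ℕ; zero; suc; _+_; _*_; _^_; _≤_; _<_; z≤n; s≤s; _≤?_)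
open import Data.Nat.Properties hiding (_≟_)
open import Data.Nat.Induction using (<-wellFounded)
open import Data.Nat.Tactic.RingSolver using (solve-∀)
open import Algebra.Properties.CommutativeMonoid.Sum +-0-commutativeMonoid
  using (sum; ∑-comm; ∑-distrib-+; sum-cong-≗; sum-replicate-zero)
open import Data.Bool using (Bool; true; false; _∨_; _∧_; not)
open import Data.Bool.Properties using (∧-conicalˡ; ∧-conicalʳ; ∨-conicalʳ; ∨-zeroʳ)
  renaming (_≟_ to _≟ᵇ_)
open import Data.Empty using (⊥; ⊥-elim)
open import Data.Fin using (Fin)
open import Data.Fin.Properties using (_≟_; any?)
open import Data.Fin.Subset using (Subset; ∣_∣)
import Data.Fin.Subset as Subset
open import Data.Product using (Σ; ∃; _×_; _,_; proj₁)
open import Data.Sum using (_⊎_; inj₁; inj₂; [_,_]′)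
open import Data.Vec using (tabulate; lookup)
open import Data.Vec.Properties using (lookup∘tabulate; tabulate-cong; []=⇒lookup; lookup⇒[]=)
open import Induction.WellFounded using (Acc; acc)
import Relation.Binary.Construct.On as On
open import Relation.Binary.PropositionalEquality hiding (J)
open import Relation.Nullary using (¬_; Dec; yes; no; does)
open import Relation.Nullary.Decidable using (_×-dec_)

private variable
  m k l : ℕ


VSet : ℕ → Set
VSet m = Fin m → Bool

infix 4 _∈_ _∉_ _⊆_
infixl 7 _∩_ _∖_
infixl 6 _∪_

_∈_ _∉_ : Fin m → VSet m → Set
v ∈ U = U v ≡ true
v ∉ U = U v ≡ false

_⊆_ : VSet m → VSet m → Set
U ⊆ V = ∀ v → v ∈ U → v ∈ V

Disjoint : VSet m → VSet m → Set
Disjoint U V = ∀ v → v ∈ U → v ∈ V → ⊥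

∅ full : VSet m
∅ _ = false
full _ = true

⁅_⁆ : Fin m → VSet m
⁅ v ⁆ w = does (w ≟ v)

_∩_ _∪_ _∖_ : VSet m → VSet m → VSet m
(U ∩ V) v = U v ∧ V v
(U ∪ V) v = U v ∨ V v
(U ∖ V) v = U v ∧ not (V v)

∈-or-∉ : (U : VSet m) (v : Fin m) → v ∈ U ⊎ v ∉ U
∈-or-∉ U v with U v
... | true  = inj₁ refl
... | false = inj₂ refl

∉⇒¬∈ : (U : VSet m) {v : Fin m} → v ∉ U → ¬ v ∈ U
∉⇒¬∈ U v∉U v∈U with () ← trans (sym v∈U) v∉U

∈∩⁺ : (U V : VSet m) {v : Fin m} → v ∈ U → v ∈ V → v ∈ U ∩ V
∈∩⁺ U V = cong₂ _∧_

∈∩⁻ˡ : (U V : VSet m) {v : Fin m} → v ∈ U ∩ V → v ∈ U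
∈∩⁻ˡ U V {v} = ∧-conicalˡ (U v) (V v)

∈∩⁻ʳ : (U V : VSet m) {v : Fin m} → v ∈ U ∩ V → v ∈ V
∈∩⁻ʳ U V {v} = ∧-conicalʳ (U v) (V v)

∈∪⁺ˡ : (U V : VSet m) {v : Fin m} → v ∈ U → v ∈ U ∪ V
∈∪⁺ˡ U V {v} v∈U = cong (_∨ V v) v∈U

∈∪⁺ʳ : (U V : VSet m) {v : Fin m} → v ∈ V → v ∈ U ∪ V
∈∪⁺ʳ U V {v} v∈V = trans (cong (U v ∨_) v∈V) (∨-zeroʳ (U v))

∈∪⁻ : (U V : VSet m) {v : Fin m} → v ∈ U ∪ V → v ∈ U ⊎ v ∈ V
∈∪⁻ U V {v} v∈U∪V with U v
... | true  = inj₁ refl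
... | false = inj₂ v∈U∪V

∈∖⁺ : (U V : VSet m) {v : Fin m} → v ∈ U → v ∉ V → v ∈ U ∖ V
∈∖⁺ U V v∈U v∉V = cong₂ (λ a b → a ∧ not b) v∈U v∉V

∈∖⁻ˡ : (U V : VSet m) {v : Fin m} → v ∈ U ∖ V → v ∈ U
∈∖⁻ˡ U V {v} = ∧-conicalˡ (U v) (not (V v))

∈∖⁻ʳ : (U V : VSet m) {v : Fin m} → v ∈ U ∖ V → v ∉ V
∈∖⁻ʳ U V {v} v∈U∖V with V v | ∧-conicalʳ (U v) (not (V v)) v∈U∖V
... | false | _ = refl

∈⁅⁆ : (v : Fin m) → v ∈ ⁅ v ⁆
∈⁅⁆ v with v ≟ v
... | yes _  = refl
... | no v≢v = ⊥-elim (v≢v refl)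

∈⁅⁆⁻ : {v w : Fin m} → w ∈ ⁅ v ⁆ → w ≡ v
∈⁅⁆⁻ {v = v} {w} w∈v with w ≟ v
... | yes w≡v = w≡v

⁅⁆⊆ : {U : VSet m} {v : Fin m} → v ∈ U → ⁅ v ⁆ ⊆ U
⁅⁆⊆ {U = U} v∈U w w∈v = subst (_∈ U) (sym (∈⁅⁆⁻ w∈v)) v∈U

empty-or-inhabited : (U : VSet m) → (∀ v → v ∉ U) ⊎ ∃ (_∈ U)
empty-or-inhabited U with any? (λ v → U v ≟ᵇ true)
... | yes inhabited = inj₂ inhabited
... | no  empty     =
  inj₁ (λ v → [ (λ v∈U → ⊥-elim (empty (v , v∈U))) , (λ v∉U → v∉U) ]′ (∈-or-∉ U v))

anyFin-intro : (f : Fin m → Bool) (i : Fin m) → f i ≡ true → anyFin f ≡ true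
anyFin-intro f Fin.zero    fi = cong (_∨ anyFin (λ j → f (Fin.suc j))) fi
anyFin-intro f (Fin.suc i) fi =
  trans (cong (f Fin.zero ∨_) (anyFin-intro (λ j → f (Fin.suc j)) i fi)) (∨-zeroʳ (f Fin.zero))

anyFin-elim : (f : Fin m → Bool) → anyFin f ≡ true → ∃ λ i → f i ≡ true
anyFin-elim {suc m} f any-f with f Fin.zero in f0
... | true  = Fin.zero , f0
... | false = let i , fi = anyFin-elim (λ j → f (Fin.suc j)) any-f in Fin.suc i , fi

anyFin-cong : (f g : Fin m → Bool) → (∀ i → f i ≡ g i) → anyFin f ≡ anyFin g
anyFin-cong {zero}  f g f≗g = refl
anyFin-cong {suc m} f g f≗g = cong₂ _∨_ (f≗g Fin.zero) (anyFin-cong _ _ (λ i → f≗g (Fin.suc i)))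

sum-mono : (f g : Fin m → ℕ) → (∀ i → f i ≤ g i) → sum f ≤ sum g
sum-mono {zero}  f g f≤g = z≤n
sum-mono {suc m} f g f≤g = +-mono-≤ (f≤g Fin.zero) (sum-mono _ _ (λ i → f≤g (Fin.suc i)))

sum-mono-< : (f g : Fin m → ℕ) → (∀ i → f i ≤ g i) → ∀ j → f j < g j → sum f < sum g
sum-mono-< f g f≤g Fin.zero    fj<gj = +-mono-<-≤ fj<gj (sum-mono _ _ (λ i → f≤g (Fin.suc i)))
sum-mono-< f g f≤g (Fin.suc j) fj<gj =
  +-mono-≤-< (f≤g Fin.zero) (sum-mono-< _ _ (λ i → f≤g (Fin.suc i)) j fj<gj)

ι : Bool → ℕ
ι true  = 1
ι false = 0

#_ : VSet m → ℕ
# U = sum (λ v → ι (U v))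

#-rec : (P : VSet m → Set) → (∀ U → (∀ V → # V < # U → P V) → P U) → ∀ U → P U
#-rec P grow U = go U (On.wellFounded #_ <-wellFounded U)
  where
  go : ∀ U → Acc (λ V W → # V < # W) U → P U
  go U (acc smaller) = grow U (λ V #V<#U → go V (smaller #V<#U))

#-empty : (U : VSet m) → (∀ v → v ∉ U) → # U ≡ 0
#-empty {m} U empty = trans (sum-cong-≗ (λ v → cong ι (empty v))) (sum-replicate-zero m)

#-full : ∀ m → # (full {m}) ≡ m
#-full zero    = refl
#-full (suc m) = cong suc (#-full m)

ι-mono : ∀ a b → (a ≡ true → b ≡ true) → ι a ≤ ι b
ι-mono false b a⇒b = z≤n
ι-mono true  b a⇒b rewrite a⇒b refl = ≤-refl

#-mono : (U V : VSet m) → U ⊆ V → # U ≤ # V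
#-mono U V U⊆V = sum-mono _ _ (λ v → ι-mono (U v) (V v) (U⊆V v))

#-∖-< : (U X : VSet m) {v : Fin m} → v ∈ U → v ∈ X → # (U ∖ X) < # U
#-∖-< U X {v} v∈U v∈X = sum-mono-< _ _
  (λ w → ι-mono (U w ∧ not (X w)) (U w) (∈∖⁻ˡ U X)) v
  (subst₂ (λ a b → ι (a ∧ not b) < ι a) (sym v∈U) (sym v∈X) ≤-refl)

#-inhabited : (U : VSet m) {v : Fin m} → v ∈ U → 1 ≤ # U
#-inhabited {m} U {v} v∈U = subst (_< # U) (sum-replicate-zero m)
  (sum-mono-< _ _ (λ _ → z≤n) v (subst (λ b → 0 < ι b) (sym v∈U) ≤-refl))

#-disjoint : (U V W : VSet m) → Disjoint U V → U ⊆ W → V ⊆ W → # U + # V ≤ # W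
#-disjoint U V W U∩V≡∅ U⊆W V⊆W = subst (_≤ # W) (∑-distrib-+ (λ v → ι (U v)) (λ v → ι (V v)))
  (sum-mono _ _ (λ v → pointwise (U v) (V v) (W v) (U∩V≡∅ v) (U⊆W v) (V⊆W v)))
  where
  pointwise : ∀ a b c → (a ≡ true → b ≡ true → ⊥) → (a ≡ true → c ≡ true) → (b ≡ true → c ≡ true) →
              ι a + ι b ≤ ι c
  pointwise false false c _ _ _ = z≤n
  pointwise false true  c _ _ b⇒c rewrite b⇒c refl = ≤-refl
  pointwise true  false c _ a⇒c _ rewrite a⇒c refl = ≤-refl
  pointwise true  true  c a∧b⇒⊥ _ _ = ⊥-elim (a∧b⇒⊥ refl refl)

#-cover : (U V W : VSet m) → W ⊆ U ∪ V → # W ≤ # U + # V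
#-cover U V W W⊆U∪V = subst (# W ≤_) (∑-distrib-+ (λ v → ι (U v)) (λ v → ι (V v)))
  (sum-mono _ _ (λ v → pointwise (U v) (V v) (W v) (W⊆U∪V v)))
  where
  pointwise : ∀ a b c → (c ≡ true → a ∨ b ≡ true) → ι c ≤ ι a + ι b
  pointwise a     b     false _   = z≤n
  pointwise true  b     true  _   = s≤s z≤n
  pointwise false true  true  _   = ≤-refl
  pointwise false false true  c⇒ with () ← c⇒ refl

#-split : (U X : VSet m) → # U ≡ # (U ∩ X) + # (U ∖ X)
#-split U X = trans (sum-cong-≗ (λ v → pointwise (U v) (X v)))
                    (∑-distrib-+ (λ v → ι ((U ∩ X) v)) (λ v → ι ((U ∖ X) v)))
  where
  pointwise : ∀ a x → ι a ≡ ι (a ∧ x) + ι (a ∧ not x)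
  pointwise false x     = refl
  pointwise true  false = refl
  pointwise true  true  = refl

tabulate-∈ : (U : VSet m) {v : Fin m} → v Subset.∈ tabulate U → v ∈ U
tabulate-∈ U {v} v∈ = trans (sym (lookup∘tabulate U v)) ([]=⇒lookup v∈)

∈-tabulate : (U : VSet m) {v : Fin m} → v ∈ U → v Subset.∈ tabulate U
∈-tabulate U {v} v∈U = lookup⇒[]= v (tabulate U) (trans (lookup∘tabulate U v) v∈U)

∣tabulate∣ : (U : VSet m) → ∣ tabulate U ∣ ≡ # U
∣tabulate∣ {zero}  U = refl
∣tabulate∣ {suc m} U with U Fin.zero | ∣tabulate∣ (λ v → U (Fin.suc v))
... | true  | ∣tail∣≡#tail = cong suc ∣tail∣≡#tail
... | false | ∣tail∣≡#tail = ∣tail∣≡#tail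

cube-gap : ∀ w → w ^ 3 + suc w ≤ suc w ^ 3
cube-gap w = subst (w ^ 3 + suc w ≤_) (sym (expand w)) (m≤m+n _ _)
  where
  -- `_^_` unfolded, as the ring solver does not handle it
  expand : ∀ w → suc w * (suc w * (suc w * 1)) ≡ w * (w * (w * 1)) + suc w + (3 * w * w + 2 * w)
  expand = solve-∀

cube-step : ∀ a z c → a ^ 3 < c → c ≤ z ^ 3 + a → c ≤ suc z ^ 3
cube-step a z c a³<c c≤z³+a with a ≤? z
... | yes a≤z = ≤-trans c≤z³+a (≤-trans (+-monoʳ-≤ (z ^ 3) (m≤n⇒m≤1+n a≤z)) (cube-gap z))
cube-step zero    z c _    _      | no 0≰z = ⊥-elim (0≰z z≤n)
cube-step (suc w) z c a³<c c≤z³+a | no a≰z = ⊥-elim (<-irrefl refl (<-≤-trans a³<c c≤a³))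
  where
  c≤a³ : c ≤ suc w ^ 3
  c≤a³ = ≤-trans c≤z³+a (≤-trans (+-monoˡ-≤ (suc w) (^-monoˡ-≤ 3 (≤-pred (≰⇒> a≰z)))) (cube-gap w))

halving-step : ∀ c s i y x → c ≤ s + i + 2 * y → i ≤ s → s + y ≤ x → c ≤ 2 * x
halving-step c s i y x c≤ i≤s s+y≤x =
  ≤-trans c≤ (≤-trans (+-monoˡ-≤ (2 * y) (+-monoʳ-≤ s i≤s))
                      (subst (_≤ 2 * x) (sym (regroup s y)) (*-monoʳ-≤ 2 s+y≤x)))
  where
  regroup : ∀ s y → s + s + 2 * y ≡ 2 * (s + y)
  regroup = solve-∀

third-step : ∀ a u x → ¬ (a + u ≤ 3 * a) → u ≤ 2 * x → a + u ≤ 3 * x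
third-step a u x a+u≰3a u≤2x = subst (a + u ≤_) (sym (split x)) (+-mono-≤ a≤x u≤2x)
  where
  split : ∀ a → 3 * a ≡ a + 2 * a
  split = solve-∀
  2a<u : 2 * a < u
  2a<u = +-cancelˡ-< a (2 * a) u (subst (_< a + u) (split a) (≰⇒> a+u≰3a))
  a≤x : a ≤ x
  a≤x = <⇒≤ (*-cancelˡ-< 2 a x (<-≤-trans 2a<u u≤2x))

-- Neighbourhoods and distances in a digraph

module _ (D : Digraph) where

  private
    N : ℕ
    N = n D

  out out[_] : VSet N → VSet N
  out S w = anyFin (λ u → S u ∧ arc D u w)
  out[ S ] = S ∪ out S

  successors predecessors : Fin N → VSet N
  successors v w = arc D v w
  predecessors v u = arc D u v

  Indep : VSet N → Set
  Indep S = ∀ u v → u ∈ S → v ∈ S → arc D u v ≡ false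

  Reach : VSet N → ℕ → Fin N → Set
  Reach S k x = ∃ λ u → u ∈ S × ∃ λ j → j ≤ k × Walk D j u x

  out-intro : (S : VSet N) {u w : Fin N} → u ∈ S → arc D u w ≡ true → w ∈ out S
  out-intro S {u} {w} u∈S uw =
    anyFin-intro (λ u → S u ∧ arc D u w) u (∈∩⁺ S (predecessors w) u∈S uw)

  out-elim : (S : VSet N) {w : Fin N} → w ∈ out S → ∃ λ u → u ∈ S × arc D u w ≡ true
  out-elim S {w} w∈out with u , u∈S∩pred ← anyFin-elim (λ u → S u ∧ arc D u w) w∈out =
    u , ∈∩⁻ˡ S (predecessors w) u∈S∩pred , ∈∩⁻ʳ S (predecessors w) u∈S∩pred

  out-absent : (S : VSet N) {u w : Fin N} → ¬ w ∈ out S → u ∈ S → arc D u w ≡ false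
  out-absent S {u} {w} w∉out u∈S with arc D u w in uw
  ... | true  = ⊥-elim (w∉out (out-intro S u∈S uw))
  ... | false = refl

  out-mono : {S T : VSet N} → S ⊆ T → out S ⊆ out T
  out-mono {S} {T} S⊆T w w∈out with u , u∈S , uw ← out-elim S w∈out = out-intro T (S⊆T u u∈S) uw

  ⊆out[] : (S : VSet N) → S ⊆ out[ S ]
  ⊆out[] S v = ∈∪⁺ˡ S (out S)

  out[]-mono : {S T : VSet N} → S ⊆ T → out[ S ] ⊆ out[ T ]
  out[]-mono {S} {T} S⊆T w w∈out[S] with ∈∪⁻ S (out S) w∈out[S]
  ... | inj₁ w∈S   = ∈∪⁺ˡ T (out T) (S⊆T w w∈S)
  ... | inj₂ w∈out = ∈∪⁺ʳ T (out T) (out-mono S⊆T w w∈out)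

  ⁅⁆-indep : (v : Fin N) → Indep ⁅ v ⁆
  ⁅⁆-indep v u w u∈v w∈v with refl ← ∈⁅⁆⁻ {v = v} {u} u∈v | refl ← ∈⁅⁆⁻ {v = v} {w} w∈v =
    loopless D v

  reach-mono : {S T : VSet N} {x : Fin N} → S ⊆ T → Reach S k x → Reach T k x
  reach-mono S⊆T (u , u∈S , walk) = u , S⊆T u u∈S , walk

  reach-weaken : {S : VSet N} {x : Fin N} → k ≤ l → Reach S k x → Reach S l x
  reach-weaken k≤l (u , u∈S , j , j≤k , walk) = u , u∈S , j , ≤-trans j≤k k≤l , walk

  out[]-reach : (S : VSet N) {x : Fin N} → x ∈ out[ S ] → Reach S 1 x
  out[]-reach S {x} x∈out[S] with ∈∪⁻ S (out S) x∈out[S]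
  ... | inj₁ x∈S   = x , x∈S , 0 , z≤n , here
  ... | inj₂ x∈out with u , u∈S , ux ← out-elim S x∈out = u , u∈S , 1 , ≤-refl , step ux here

  extend : VSet N → VSet N → VSet N
  extend Q J = J ∪ (Q ∖ out J)

  ⊆-extend : (Q J : VSet N) → J ⊆ extend Q J
  ⊆-extend Q J v = ∈∪⁺ˡ J (Q ∖ out J)

  extend-⊆ : (Q J U : VSet N) → Q ⊆ U → J ⊆ U → extend Q J ⊆ U
  extend-⊆ Q J U Q⊆U J⊆U v v∈ext with ∈∪⁻ J (Q ∖ out J) v∈ext
  ... | inj₁ v∈J    = J⊆U v v∈J
  ... | inj₂ v∈Q∖out = Q⊆U v (∈∖⁻ˡ Q (out J) v∈Q∖out)

  ⊆out[extend] : (Q J : VSet N) → Q ⊆ out[ extend Q J ]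
  ⊆out[extend] Q J v v∈Q with ∈-or-∉ (out J) v
  ... | inj₁ v∈out = ∈∪⁺ʳ (extend Q J) (out (extend Q J)) (out-mono (⊆-extend Q J) v v∈out)
  ... | inj₂ v∉out = ⊆out[] (extend Q J) v (∈∪⁺ʳ J (Q ∖ out J) (∈∖⁺ Q (out J) v∈Q v∉out))

  reach-extend : (Q J : VSet N) {x : Fin N} → Reach Q k x → Reach (extend Q J) (suc k) x
  reach-extend Q J (u , u∈Q , j , j≤k , walk) with ∈-or-∉ (out J) u
  ... | inj₁ u∈out with w , w∈J , wu ← out-elim J u∈out =
    w , ⊆-extend Q J w w∈J , suc j , s≤s j≤k , step wu walk
  ... | inj₂ u∉out = u , ∈∪⁺ʳ J (Q ∖ out J) (∈∖⁺ Q (out J) u∈Q u∉out) , j , m≤n⇒m≤1+n j≤k , walk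

  extend-indep : (Q J : VSet N) → Indep Q → Indep J → Disjoint J out[ Q ] → Indep (extend Q J)
  extend-indep Q J Q-indep J-indep J∩out[Q]≡∅ u v u∈ext v∈ext
    with ∈∪⁻ J (Q ∖ out J) u∈ext | ∈∪⁻ J (Q ∖ out J) v∈ext
  ... | inj₁ u∈J | inj₁ v∈J = J-indep u v u∈J v∈J
  ... | inj₁ u∈J | inj₂ v∈Q∖out = out-absent J (∉⇒¬∈ (out J) (∈∖⁻ʳ Q (out J) v∈Q∖out)) u∈J
  ... | inj₂ u∈Q∖out | inj₁ v∈J =
    out-absent Q (λ v∈out → J∩out[Q]≡∅ v v∈J (∈∪⁺ʳ Q (out Q) v∈out)) (∈∖⁻ˡ Q (out J) u∈Q∖out)
  ... | inj₂ u∈Q∖out | inj₂ v∈Q∖out = Q-indep u v (∈∖⁻ˡ Q (out J) u∈Q∖out) (∈∖⁻ˡ Q (out J) v∈Q∖out)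

  -- Large quasikernels

  -- Distances are measured in D, not in the induced subdigraph D[U].
  record QuasikernelIn (U : VSet N) : Set where
    field
      kernel       : VSet N
      kernel⊆U     : kernel ⊆ U
      kernel-indep : Indep kernel
      kernel-reach : ∀ x → x ∈ U → Reach kernel 2 x
  open QuasikernelIn

  ∅-quasikernel : (U : VSet N) → (∀ v → v ∉ U) → QuasikernelIn U
  ∅-quasikernel U U-empty .kernel         = ∅
  ∅-quasikernel U U-empty .kernel⊆U _ ()
  ∅-quasikernel U U-empty .kernel-indep _ _ ()
  ∅-quasikernel U U-empty .kernel-reach x x∈U = ⊥-elim (∉⇒¬∈ U (U-empty x) x∈U)

  extend-quasikernel : (U S : VSet N) → S ⊆ U → Indep S →
                       QuasikernelIn (U ∖ out[ S ]) → QuasikernelIn U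
  extend-quasikernel U S S⊆U S-indep K .kernel = extend S (kernel K)
  extend-quasikernel U S S⊆U S-indep K .kernel⊆U =
    extend-⊆ S (kernel K) U S⊆U (λ v v∈K → ∈∖⁻ˡ U out[ S ] (kernel⊆U K v v∈K))
  extend-quasikernel U S S⊆U S-indep K .kernel-indep =
    extend-indep S (kernel K) S-indep (kernel-indep K)
      (λ v v∈K → ∉⇒¬∈ out[ S ] (∈∖⁻ʳ U out[ S ] (kernel⊆U K v v∈K)))
  extend-quasikernel U S S⊆U S-indep K .kernel-reach x x∈U with ∈-or-∉ out[ S ] x
  ... | inj₁ x∈out[S] = reach-extend S (kernel K) (out[]-reach S x∈out[S])
  ... | inj₂ x∉out[S] =
    reach-mono (⊆-extend S (kernel K)) (kernel-reach K x (∈∖⁺ U out[ S ] x∈U x∉out[S]))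

  LargeQuasikernel : VSet N → Set
  LargeQuasikernel U = Σ (QuasikernelIn U) λ K → # U ≤ # (U ∩ out[ kernel K ]) ^ 3

  -- Extending K gains the covered vertices K (nonempty, outside U ∖ N⁺[K]) on top of the z
  -- already covered in U ∖ N⁺[K], and a³ < |U| ≤ a + z³ forces |U| ≤ (z + 1)³.
  extend-large : (U : VSet N) (K : QuasikernelIn U) {v : Fin N} → v ∈ U →
                 # (U ∩ out[ kernel K ]) ^ 3 < # U →
                 LargeQuasikernel (U ∖ out[ kernel K ]) → LargeQuasikernel U
  extend-large U K {v} v∈U a³<#U (L , #U′≤z³) = K′ , ≤-trans #U≤[1+z]³ (^-monoˡ-≤ 3 1+z≤x)
    where
    Q J U′ : VSet N
    Q = kernel K
    J = kernel L
    U′ = U ∖ out[ Q ]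
    K′ : QuasikernelIn U
    K′ = extend-quasikernel U Q (kernel⊆U K) (kernel-indep K) L
    a z x : ℕ
    a = # (U ∩ out[ Q ])
    z = # (U′ ∩ out[ J ])
    x = # (U ∩ out[ extend Q J ])

    #U≤z³+a : # U ≤ z ^ 3 + a
    #U≤z³+a = begin
      # U         ≡⟨ #-split U out[ Q ] ⟩
      a + # U′    ≡⟨ +-comm a (# U′) ⟩
      # U′ + a    ≤⟨ +-monoˡ-≤ a #U′≤z³ ⟩
      z ^ 3 + a   ∎
      where open ≤-Reasoning
    #U≤[1+z]³ : # U ≤ suc z ^ 3
    #U≤[1+z]³ = cube-step a z (# U) a³<#U #U≤z³+a

    1≤#Q : 1 ≤ # Q
    1≤#Q with u , u∈Q , _ ← kernel-reach K v v∈U = #-inhabited Q u∈Q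
    #Q+z≤x : # Q + z ≤ x
    #Q+z≤x = #-disjoint Q (U′ ∩ out[ J ]) (U ∩ out[ extend Q J ])
      (λ u u∈Q u∈U′∩ → ∉⇒¬∈ out[ Q ] (∈∖⁻ʳ U out[ Q ] (∈∩⁻ˡ U′ out[ J ] u∈U′∩)) (⊆out[] Q u u∈Q))
      (λ u u∈Q → ∈∩⁺ U out[ extend Q J ] (kernel⊆U K u u∈Q) (⊆out[extend] Q J u u∈Q))
      (λ u u∈U′∩ → ∈∩⁺ U out[ extend Q J ]
         (∈∖⁻ˡ U out[ Q ] (∈∩⁻ˡ U′ out[ J ] u∈U′∩))
         (out[]-mono (⊆-extend Q J) u (∈∩⁻ʳ U′ out[ J ] u∈U′∩)))
    1+z≤x : suc z ≤ x
    1+z≤x = ≤-trans (+-monoˡ-≤ z 1≤#Q) #Q+z≤x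

  large-quasikernel : (U : VSet N) → LargeQuasikernel U
  large-quasikernel = #-rec LargeQuasikernel grow
    where
    grow : ∀ U → (∀ V → # V < # U → LargeQuasikernel V) → LargeQuasikernel U
    grow U rec with empty-or-inhabited U
    ... | inj₁ U-empty = ∅-quasikernel U U-empty , ≤-trans (≤-reflexive (#-empty U U-empty)) z≤n
    ... | inj₂ (v , v∈U) = refine (# U ≤? # (U ∩ out[ kernel K₁ ]) ^ 3)
      where
      K₀ : QuasikernelIn (U ∖ out[ ⁅ v ⁆ ])
      K₀ = proj₁ (rec _ (#-∖-< U out[ ⁅ v ⁆ ] v∈U (⊆out[] ⁅ v ⁆ v (∈⁅⁆ v))))
      K₁ : QuasikernelIn U
      K₁ = extend-quasikernel U ⁅ v ⁆ (⁅⁆⊆ v∈U) (⁅⁆-indep v) K₀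
      refine : Dec (# U ≤ # (U ∩ out[ kernel K₁ ]) ^ 3) → LargeQuasikernel U
      refine (yes small) = K₁ , small
      refine (no big)    = extend-large U K₁ v∈U (≰⇒> big)
        (rec _ (#-∖-< U out[ kernel K₁ ] v∈U (⊆out[extend] ⁅ v ⁆ (kernel K₀) v (∈⁅⁆ v))))

  -- Large independent sets

  outdeg indeg : VSet N → Fin N → ℕ
  outdeg U v = # (U ∩ successors v)
  indeg  U v = # (U ∩ predecessors v)

  -- Summed over U, both degrees count the arcs of D[U]; so they cannot all satisfy outdeg < indeg.
  ∃-indeg≤outdeg : (U : VSet N) {v : Fin N} → v ∈ U → ∃ λ w → w ∈ U × indeg U w ≤ outdeg U w
  ∃-indeg≤outdeg U {v} v∈U with any? (λ w → (U w ≟ᵇ true) ×-dec (indeg U w ≤? outdeg U w))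
  ... | yes found = found
  ... | no  none  = ⊥-elim (<-irrefl handshake (sum-mono-< outᵁ inᵁ outᵁ≤inᵁ v (outᵁ<inᵁ v v∈U)))
    where
    arcᵁ : Fin N → Fin N → ℕ
    arcᵁ u w = ι (U u ∧ (U w ∧ arc D u w))
    outᵁ inᵁ : Fin N → ℕ
    outᵁ u = sum (arcᵁ u)
    inᵁ  w = sum (λ u → arcᵁ u w)

    handshake : sum outᵁ ≡ sum inᵁ
    handshake = ∑-comm arcᵁ
    outᵁ<inᵁ : ∀ w → w ∈ U → outᵁ w < inᵁ w
    outᵁ<inᵁ w w∈U = subst₂ _<_
      (sum-cong-≗ (λ x → cong (λ b → ι (b ∧ (U x ∧ arc D w x))) (sym w∈U)))
      (sum-cong-≗ (λ u → cong (λ b → ι (U u ∧ (b ∧ arc D u w))) (sym w∈U)))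
      (≰⇒> (λ in≤out → none (w , w∈U , in≤out)))
    outᵁ≤inᵁ : ∀ w → outᵁ w ≤ inᵁ w
    outᵁ≤inᵁ w with ∈-or-∉ U w
    ... | inj₁ w∈U = <⇒≤ (outᵁ<inᵁ w w∈U)
    ... | inj₂ w∉U = ≤-trans (≤-reflexive outᵁ≡0) z≤n
      where
      outᵁ≡0 : outᵁ w ≡ 0
      outᵁ≡0 = trans (sum-cong-≗ (λ x → cong (λ b → ι (b ∧ (U x ∧ arc D w x))) w∉U))
                     (sum-replicate-zero N)

  LargeIndependent : VSet N → Set
  LargeIndependent U = Σ (VSet N) λ J → J ⊆ U × Indep J × # U ≤ 2 * # (U ∩ out[ J ])

  -- Adding v to an independent set of U ∖ (N⁺[v] ∪ N⁻(v)) newly covers the s vertices of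
  -- U ∩ N⁺[v], while only s + indeg v ≤ 2s vertices of U were discarded.
  add-vertex : (U : VSet N) {v : Fin N} → v ∈ U → indeg U v ≤ outdeg U v →
               LargeIndependent (U ∖ (out[ ⁅ v ⁆ ] ∪ predecessors v)) → LargeIndependent U
  add-vertex U {v} v∈U in≤out (J′ , J′⊆U′ , J′-indep , #U′≤2y) = J , J⊆U , J-indep , #U≤2x
    where
    X U′ J : VSet N
    X = out[ ⁅ v ⁆ ] ∪ predecessors v
    U′ = U ∖ X
    J = ⁅ v ⁆ ∪ J′
    s y x : ℕ
    s = # (U ∩ out[ ⁅ v ⁆ ])
    y = # (U′ ∩ out[ J′ ])
    x = # (U ∩ out[ J ])

    J′∩X≡∅ : ∀ w → w ∈ J′ → w ∉ X
    J′∩X≡∅ w w∈J′ = ∈∖⁻ʳ U X (J′⊆U′ w w∈J′)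

    J⊆U : J ⊆ U
    J⊆U w w∈J with ∈∪⁻ ⁅ v ⁆ J′ w∈J
    ... | inj₁ w∈v  = ⁅⁆⊆ v∈U w w∈v
    ... | inj₂ w∈J′ = ∈∖⁻ˡ U X (J′⊆U′ w w∈J′)

    J-indep : Indep J
    J-indep u w u∈J w∈J with ∈∪⁻ ⁅ v ⁆ J′ u∈J | ∈∪⁻ ⁅ v ⁆ J′ w∈J
    ... | inj₁ u∈v  | inj₁ w∈v  = ⁅⁆-indep v u w u∈v w∈v
    ... | inj₁ u∈v  | inj₂ w∈J′ = out-absent ⁅ v ⁆
          (λ w∈out → ∉⇒¬∈ X (J′∩X≡∅ w w∈J′)
                       (∈∪⁺ˡ out[ ⁅ v ⁆ ] (predecessors v) (∈∪⁺ʳ ⁅ v ⁆ (out ⁅ v ⁆) w∈out)))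
          u∈v
    ... | inj₂ u∈J′ | inj₁ w∈v with refl ← ∈⁅⁆⁻ {v = v} {w} w∈v =
          ∨-conicalʳ (out[ ⁅ v ⁆ ] u) (arc D u v) (J′∩X≡∅ u u∈J′)
    ... | inj₂ u∈J′ | inj₂ w∈J′ = J′-indep u w u∈J′ w∈J′

    #U∩X≤s+indeg : # (U ∩ X) ≤ s + indeg U v
    #U∩X≤s+indeg = #-cover (U ∩ out[ ⁅ v ⁆ ]) (U ∩ predecessors v) (U ∩ X) λ w w∈U∩X →
      let w∈U = ∈∩⁻ˡ U X w∈U∩X in
      [ (λ w∈out → ∈∪⁺ˡ (U ∩ out[ ⁅ v ⁆ ]) (U ∩ predecessors v) (∈∩⁺ U out[ ⁅ v ⁆ ] w∈U w∈out))
      , (λ w∈pred → ∈∪⁺ʳ (U ∩ out[ ⁅ v ⁆ ]) (U ∩ predecessors v)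
                        (∈∩⁺ U (predecessors v) w∈U w∈pred))
      ]′ (∈∪⁻ out[ ⁅ v ⁆ ] (predecessors v) (∈∩⁻ʳ U X w∈U∩X))

    outdeg≤s : outdeg U v ≤ s
    outdeg≤s = #-mono (U ∩ successors v) (U ∩ out[ ⁅ v ⁆ ]) λ w w∈ →
      ∈∩⁺ U out[ ⁅ v ⁆ ] (∈∩⁻ˡ U (successors v) w∈)
        (∈∪⁺ʳ ⁅ v ⁆ (out ⁅ v ⁆) (out-intro ⁅ v ⁆ (∈⁅⁆ v) (∈∩⁻ʳ U (successors v) w∈)))

    s+y≤x : s + y ≤ x
    s+y≤x = #-disjoint (U ∩ out[ ⁅ v ⁆ ]) (U′ ∩ out[ J′ ]) (U ∩ out[ J ])
      (λ w w∈out[v] w∈U′∩ → ∉⇒¬∈ X (∈∖⁻ʳ U X (∈∩⁻ˡ U′ out[ J′ ] w∈U′∩))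
                              (∈∪⁺ˡ out[ ⁅ v ⁆ ] (predecessors v) (∈∩⁻ʳ U out[ ⁅ v ⁆ ] w∈out[v])))
      (λ w w∈ → ∈∩⁺ U out[ J ] (∈∩⁻ˡ U out[ ⁅ v ⁆ ] w∈)
                  (out[]-mono (λ u → ∈∪⁺ˡ ⁅ v ⁆ J′) w (∈∩⁻ʳ U out[ ⁅ v ⁆ ] w∈)))
      (λ w w∈ → ∈∩⁺ U out[ J ] (∈∖⁻ˡ U X (∈∩⁻ˡ U′ out[ J′ ] w∈))
                  (out[]-mono (λ u → ∈∪⁺ʳ ⁅ v ⁆ J′) w (∈∩⁻ʳ U′ out[ J′ ] w∈)))

    #U≤2x : # U ≤ 2 * x
    #U≤2x = halving-step (# U) s (indeg U v) y x #U≤s+indeg+2y (≤-trans in≤out outdeg≤s) s+y≤x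
      where
      open ≤-Reasoning
      #U≤s+indeg+2y : # U ≤ s + indeg U v + 2 * y
      #U≤s+indeg+2y = begin
        # U                    ≡⟨ #-split U X ⟩
        # (U ∩ X) + # U′       ≤⟨ +-mono-≤ #U∩X≤s+indeg #U′≤2y ⟩
        s + indeg U v + 2 * y  ∎

  large-independent : (U : VSet N) → LargeIndependent U
  large-independent = #-rec LargeIndependent grow
    where
    grow : ∀ U → (∀ V → # V < # U → LargeIndependent V) → LargeIndependent U
    grow U rec with empty-or-inhabited U
    ... | inj₁ U-empty = ∅ , (λ _ ()) , (λ _ _ ()) , ≤-trans (≤-reflexive (#-empty U U-empty)) z≤n
    ... | inj₂ (v₀ , v₀∈U) with v , v∈U , in≤out ← ∃-indeg≤outdeg U v₀∈U =
      add-vertex U v∈U in≤out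
        (rec _ (#-∖-< U X v∈U (∈∪⁺ˡ out[ ⁅ v ⁆ ] (predecessors v) (⊆out[] ⁅ v ⁆ v (∈⁅⁆ v)))))
      where
      X : VSet N
      X = out[ ⁅ v ⁆ ] ∪ predecessors v

  quasikernel-of-D : Σ (VSet N) λ Q → Indep Q × (∀ x → Reach Q 2 x) × N ≤ # out[ Q ] ^ 3
  quasikernel-of-D with K , #V≤a³ ← large-quasikernel full =
    kernel K , kernel-indep K , (λ x → kernel-reach K x refl) ,
    subst (_≤ # out[ kernel K ] ^ 3) (#-full N) #V≤a³

  3-kernel-from-quasikernel : (Q : VSet N) → Indep Q → (∀ x → Reach Q 2 x) →
                              Σ (VSet N) λ C → Indep C × (∀ x → Reach C 3 x) × N ≤ 3 * # out[ C ]
  3-kernel-from-quasikernel Q Q-indep Q-reach with N ≤? 3 * # out[ Q ]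
  ... | yes N≤3a = Q , Q-indep , (λ x → reach-weaken (n≤1+n 2) (Q-reach x)) , N≤3a
  ... | no  N≰3a with J , J⊆U , J-indep , #U≤2y ← large-independent (full ∖ out[ Q ]) =
    extend Q J ,
    extend-indep Q J Q-indep J-indep (λ v v∈J → ∉⇒¬∈ out[ Q ] (∈∖⁻ʳ full out[ Q ] (J⊆U v v∈J))) ,
    (λ x → reach-extend Q J (Q-reach x)) ,
    subst (_≤ 3 * x) (sym N≡a+u)
      (third-step a u x (λ a+u≤3a → N≰3a (subst (_≤ 3 * a) (sym N≡a+u) a+u≤3a)) u≤2x)
    where
    U : VSet N
    U = full ∖ out[ Q ]
    a u x : ℕ
    a = # out[ Q ]
    u = # U
    x = # out[ extend Q J ]
    N≡a+u : N ≡ a + u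
    N≡a+u = trans (sym (#-full N)) (#-split full out[ Q ])
    u≤2x : u ≤ 2 * x
    u≤2x = ≤-trans #U≤2y (*-monoʳ-≤ 2 (#-mono (U ∩ out[ J ]) out[ extend Q J ]
             (λ v v∈ → out[]-mono (⊆-extend Q J) v (∈∩⁻ʳ U out[ J ] v∈))))

  kernel-tabulate : (S : VSet N) → Indep S → (∀ x → Reach S k x) → IsKernel k D (tabulate S)
  kernel-tabulate S S-indep S-reach =
    (λ u v u∈S v∈S → S-indep u v (tabulate-∈ S u∈S) (tabulate-∈ S v∈S)) ,
    λ x → let u , u∈S , walk = S-reach x in u , ∈-tabulate S u∈S , walk

  ∣N⁺[tabulate]∣ : (S : VSet N) → ∣ N⁺[_] {D} (tabulate S) ∣ ≡ # out[ S ]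
  ∣N⁺[tabulate]∣ S = trans (cong ∣_∣ (tabulate-cong λ v →
      cong₂ _∨_ (lookup∘tabulate S v)
                (anyFin-cong _ _ λ u → cong (_∧ arc D u v) (lookup∘tabulate S u))))
    (∣tabulate∣ out[ S ])

  to-Subset : (P : ℕ → Set) →
              (Σ (VSet N) λ S → Indep S × (∀ x → Reach S k x) × P (# out[ S ])) →
              Σ (Subset N) λ S → IsKernel k D S × P ∣ N⁺[_] {D} S ∣
  to-Subset P (S , S-indep , S-reach , P-S) =
    tabulate S , kernel-tabulate S S-indep S-reach , subst P (sym (∣N⁺[tabulate]∣ S)) P-S

theorem2p10 : (D : Digraph) →
    (Σ (Subset (n D)) λ Q → IsQuasikernel D Q × n D ≤ ∣ N⁺[_] {D} Q ∣ ^ 3)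
    × (Σ (Subset (n D)) λ Q → IsKernel 3 D Q × n D ≤ 3 * ∣ N⁺[_] {D} Q ∣)
theorem2p10 D with Q , Q-indep , Q-reach , _ ← quasikernel-of-D D =
  to-Subset D (λ s → n D ≤ s ^ 3) (quasikernel-of-D D) ,
  to-Subset D (λ s → n D ≤ 3 * s) (3-kernel-from-quasikernel D Q Q-indep Q-reach)
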